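{- Let $m\ge 1$ and for $i=1,\dots,m$ let $u_i>0$, $v_i>0$, $d_i:=u_i+v_i$, and $D:=\max_i d_i$. Let $\delta\ge 0$. If there is an index $i$ with $d_i\in[\delta D,(1-\delta)D]$, then there exists a pattern (equivalently, a vector $z$ with $z_k\in\{v_k,-u_k\}$ for all $k$) with additive performance at most $\bigl(\frac32-\frac\delta2\bigr)D$.
   Context: This is the reduced form of the Ring Loading Problem: a ring on $2m$ nodes with a demand $d_i$ between node $i$ and node $i+m$ for $i=1,\dots,m$, and a given split routing sending $u_i$ units clockwise and $v_i$ units counterclockwise. An unsplittable solution is a vector $z=(z_1,\dots,z_m)$ with $z_i\in\{v_i,-u_i\}$. Its additive performance is $\max_{k=1,\dots,m}\bigl|\sum_{i=1}^k z_i-\sum_{i=k+1}^m z_i\bigr|$ (the maximum increase of an edge load compared to the split routing). For $x\in\mathbb{R}$, the pattern $p_z$ starting at $x$ is the function $p_z(k):=x+\sum_{i=1}^k z_i$ for $k=0,1,\dots,m$; its start point is $p_z(0)=x$, its end point is $p_z(m)$, and it lives on the strip $[a,b]$ with $a=\min_k p_z(k)$, $b=\max_k p_z(k)$. The additive performance of a pattern is that of $z$.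
   Formalization: The values $u_i$, $v_i$ and the parameter $\delta$ are rational numbers. -}

module Defs where

open import Data.Nat using (ℕ; zero; suc)
open import Data.Fin using (Fin; zero; suc)
open import Data.Rational using (ℚ; 0ℚ; 1ℚ; _+_; _-_; _*_; -_; _⊔_; ∣_∣; _≤_; _<_; ½)
open import Data.Product using (_×_; Σ)
open import Data.Sum using (_⊎_)
open import Relation.Binary.PropositionalEquality using (_≡_)

demand : ∀ {m} → (Fin m → ℚ) → (Fin m → ℚ) → Fin m → ℚ
demand u v i = u i + v i

-- maximum of a finite nonempty family (0 for the empty family, never used since m ≥ 1)
maxFin : ∀ {m} → (Fin m → ℚ) → ℚ
maxFin {zero} f = 0ℚ
maxFin {suc zero} f = f zero
maxFin {suc (suc m)} f = f zero ⊔ maxFin {suc m} (λ i → f (suc i))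

Dmax : ∀ {m} → (Fin m → ℚ) → (Fin m → ℚ) → ℚ
Dmax u v = maxFin (demand u v)

-- sumFirst z k = z_1 + ... + z_k   (first k entries, capped at m)
sumFirst : ∀ {m} → (Fin m → ℚ) → ℕ → ℚ
sumFirst {zero} z k = 0ℚ
sumFirst {suc m} z zero = 0ℚ
sumFirst {suc m} z (suc k) = z zero + sumFirst {m} (λ i → z (suc i)) k

sumAll : ∀ {m} → (Fin m → ℚ) → ℚ
sumAll {m} z = sumFirst z m

edgeIncrease : ∀ {m} → (Fin m → ℚ) → ℕ → ℚ
edgeIncrease z k = ∣ sumFirst z k - (sumAll z - sumFirst z k) ∣

-- max_{k = 1..n} f k   (0 for n = 0)
maxUpTo : (ℕ → ℚ) → ℕ → ℚ
maxUpTo f zero = 0ℚ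
maxUpTo f (suc zero) = f 1
maxUpTo f (suc (suc n)) = maxUpTo f (suc n) ⊔ f (suc (suc n))

additivePerformance : ∀ {m} → (Fin m → ℚ) → ℚ
additivePerformance {m} z = maxUpTo (edgeIncrease z) m

IsUnsplittable : ∀ {m} → (Fin m → ℚ) → (Fin m → ℚ) → (Fin m → ℚ) → Set
IsUnsplittable u v z = ∀ k → (z k ≡ v k) ⊎ (z k ≡ - u k)

-- Let i be the index with δD ≤ dᵢ ≤ (1 − δ)D, let B = (3/2 − δ/2)D and Sₖ = z₁ + ⋯ + zₖ, so
-- that the increase on edge k is |2Sₖ − Sₘ|. Fix a window W = [lo, lo + D] containing 0. A
-- greedy walk (step +a if that stays below lo + D, otherwise −b) never leaves W when a + b ≤ D.
-- Route the demands after i by such a walk from 0 and let Q be its total; route the demands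
-- before i so that Q − Sₖ is such a walk from Q; route demand i so that A = Q − Sᵢ₊₁ lands in
-- [2(lo + D) − B, 2lo + B]. As Sₘ = Sᵢ₊₁ + Q, every edge increase is ±(A − 2w) with w ∈ W,
-- hence at most B. The target interval has length 2B − 2D = (1 − δ)D ≥ dᵢ, and δD ≤ dᵢ
-- leaves room for the choice lo = (uᵢ − vᵢ − D)/2.
module Submission where

open import Defs
open import Data.Nat using (ℕ; zero; suc)
import Data.Nat as ℕ
import Data.Nat.Properties as ℕ
open import Data.Fin using (Fin; zero; suc; toℕ)
open import Function using (_∘_)
open import Data.Vec.Functional using (head; tail)
open import Data.Rational using (ℚ; 0ℚ; 1ℚ; _+_; _-_; _*_; -_; _≤_; _<_; ½; ∣_∣)
open import Data.Rational.Properties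
  using (_≟_; _≤?_; +-*-commutativeRing; ≤-refl; ≤-trans; <⇒≤; ≰⇒>; +-monoˡ-≤; +-monoʳ-≤; +-mono-≤;
         *-monoˡ-≤-nonNeg; +-identityˡ; +-identityʳ; +-inverseʳ; +-assoc; +-0-group; +-comm;
         ∣p∣≡p∨∣p∣≡-p; ∣-p∣≡∣p∣; p≤p⊔q; p≤q⊔p; ⊔-lub)
open import Data.Product using (_×_; Σ; _,_; uncurry)
open import Data.Sum using (inj₁; inj₂)
open import Data.List using (_∷_; [])
open import Level using (0ℓ)
open import Relation.Nullary.Decidable using (yes; no; dec⇒maybe)
open import Relation.Binary.PropositionalEquality using (_≡_; refl; sym; trans; cong; subst; subst₂)
open import Tactic.RingSolver.Core.AlmostCommutativeRing using (AlmostCommutativeRing; fromCommutativeRing)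
open import Tactic.RingSolver using (solve; solve-∀)
open import Algebra.Properties.Group +-0-group using (⁻¹-involutive)

ℚ-ring : AlmostCommutativeRing 0ℓ 0ℓ
ℚ-ring = fromCommutativeRing +-*-commutativeRing (λ p → dec⇒maybe (0ℚ ≟ p))

-- Linear inequalities are proved by writing the difference of the two sides as a
-- sum of nonnegative terms; the ring solver checks that identity.
≤-certified : ∀ {p q c} → 0ℚ ≤ c → c ≡ q - p → p ≤ q
≤-certified {p} {q} 0≤c refl =
  subst₂ _≤_ (+-identityʳ p) p+[q-p]≡q (+-monoʳ-≤ p 0≤c)
  where
  p+[q-p]≡q : p + (q - p) ≡ q
  p+[q-p]≡q = solve (p ∷ q ∷ []) ℚ-ring

≤⇒0≤- : ∀ {p q} → p ≤ q → 0ℚ ≤ q - p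
≤⇒0≤- {p} {q} p≤q = subst (_≤ q - p) (+-inverseʳ p) (+-monoˡ-≤ (- p) p≤q)

0≤+ : ∀ {p q} → 0ℚ ≤ p → 0ℚ ≤ q → 0ℚ ≤ p + q
0≤+ = +-mono-≤

0≤½* : ∀ {p} → 0ℚ ≤ p → 0ℚ ≤ ½ * p
0≤½* = *-monoˡ-≤-nonNeg ½

infix 4 _∈[_,_]
_∈[_,_] : ℚ → ℚ → ℚ → Set
p ∈[ a , b ] = a ≤ p × p ≤ b

∣p∣≤q : ∀ {p q} → p ∈[ - q , q ] → ∣ p ∣ ≤ q
∣p∣≤q {p} {q} (-q≤p , p≤q) with ∣p∣≡p∨∣p∣≡-p p
... | inj₁ ∣p∣≡p  = subst (_≤ q) (sym ∣p∣≡p) p≤q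
... | inj₂ ∣p∣≡-p = subst (_≤ q) (sym ∣p∣≡-p) (≤-certified (≤⇒0≤- -q≤p) (solve (p ∷ q ∷ []) ℚ-ring))

∣p-[q+q]∣≤r : ∀ {a b p q r} → q ∈[ a , b ] → p ∈[ (b + b) - r , (a + a) + r ] → ∣ p - (q + q) ∣ ≤ r
∣p-[q+q]∣≤r {a} {b} {p} {q} {r} (a≤q , q≤b) (lower , upper) = ∣p∣≤q
  ( ≤-certified (0≤+ (≤⇒0≤- lower) (0≤+ (≤⇒0≤- q≤b) (≤⇒0≤- q≤b))) (solve (a ∷ b ∷ p ∷ q ∷ r ∷ []) ℚ-ring)
  , ≤-certified (0≤+ (≤⇒0≤- upper) (0≤+ (≤⇒0≤- a≤q) (≤⇒0≤- a≤q))) (solve (a ∷ b ∷ p ∷ q ∷ r ∷ []) ℚ-ring))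

[p+c]-S≡p-[-c+S] : ∀ p c S → (p + c) - S ≡ p - (- c + S)
[p+c]-S≡p-[-c+S] = solve-∀ ℚ-ring

sumFirst-1 : ∀ {m} (z : Fin (suc m) → ℚ) → sumFirst z 1 ≡ head z
sumFirst-1 {zero}  z = +-identityʳ (head z)
sumFirst-1 {suc m} z = +-identityʳ (head z)

maxFin-upper : ∀ {m} (f : Fin m → ℚ) k → f k ≤ maxFin f
maxFin-upper {suc zero}    f zero    = ≤-refl
maxFin-upper {suc (suc m)} f zero    = p≤p⊔q (f zero) _
maxFin-upper {suc (suc m)} f (suc k) = ≤-trans (maxFin-upper (tail f) k) (p≤q⊔p (f zero) _)

maxUpTo-lub : ∀ (f : ℕ → ℚ) {B} n → (∀ k → f k ≤ B) → maxUpTo f (suc n) ≤ B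
maxUpTo-lub f zero    f≤B = f≤B 1
maxUpTo-lub f (suc n) f≤B = ⊔-lub (maxUpTo-lub f n f≤B) (f≤B (suc (suc n)))

record Admissible (D a b : ℚ) : Set where
  field
    0≤a   : 0ℚ ≤ a
    0≤b   : 0ℚ ≤ b
    a+b≤D : a + b ≤ D

admissible-swap : ∀ {D a b} → Admissible D a b → Admissible D b a
admissible-swap {D} {a} {b} adm = record
  { 0≤a   = 0≤b
  ; 0≤b   = 0≤a
  ; a+b≤D = subst (_≤ D) (+-comm a b) a+b≤D
  }
  where open Admissible adm

module Window (lo D : ℚ) where

  InWindow : ℚ → Set
  InWindow p = p ∈[ lo , lo + D ]

  greedyStep : ℚ → ℚ → ℚ → ℚ
  greedyStep a b p with p + a ≤? lo + D
  ... | yes _ = a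
  ... | no  _ = - b

  greedyStep-∈ : ∀ {a b p} → Admissible D a b → InWindow p → InWindow (p + greedyStep a b p)
  greedyStep-∈ {a} {b} {p} adm (lo≤p , p≤hi) with p + a ≤? lo + D
  ... | yes p+a≤hi = up , p+a≤hi
    where
    open Admissible adm
    up : lo ≤ p + a
    up = ≤-certified (0≤+ (≤⇒0≤- lo≤p) 0≤a) (solve (a ∷ p ∷ lo ∷ []) ℚ-ring)
  ... | no  p+a≰hi = down , back
    where
    open Admissible adm
    down : lo ≤ p - b
    down = ≤-certified (0≤+ (≤⇒0≤- (<⇒≤ (≰⇒> p+a≰hi))) (≤⇒0≤- a+b≤D)) (solve (a ∷ b ∷ p ∷ lo ∷ D ∷ []) ℚ-ring)
    back : p - b ≤ lo + D
    back = ≤-certified (0≤+ (≤⇒0≤- p≤hi) 0≤b) (solve (b ∷ p ∷ lo ∷ D ∷ []) ℚ-ring)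

  greedy : ∀ {n} → (a b : Fin n → ℚ) → ℚ → Fin n → ℚ
  greedy a b p zero    = greedyStep (head a) (head b) p
  greedy a b p (suc k) = greedy (tail a) (tail b) (p + greedyStep (head a) (head b) p) k

  greedy-unsplittable : ∀ {n} (a b : Fin n → ℚ) p → IsUnsplittable b a (greedy a b p)
  greedy-unsplittable a b p zero with p + head a ≤? lo + D
  ... | yes _ = inj₁ refl
  ... | no  _ = inj₂ refl
  greedy-unsplittable a b p (suc k) = greedy-unsplittable (tail a) (tail b) _ k

  greedy-∈ : ∀ {n} {a b : Fin n → ℚ} {p} → (∀ j → Admissible D (a j) (b j)) → InWindow p →
             ∀ k → InWindow (p + sumFirst (greedy a b p) k)
  greedy-∈ {zero}  {p = p} _ p∈W k = subst InWindow (sym (+-identityʳ p)) p∈W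
  greedy-∈ {suc n} {p = p} _ p∈W zero = subst InWindow (sym (+-identityʳ p)) p∈W
  greedy-∈ {suc n} {p = p} adm p∈W (suc k) =
    subst InWindow (+-assoc p _ _) (greedy-∈ (adm ∘ suc) (greedyStep-∈ (adm zero) p∈W) k)

  postTotal : ∀ {m} → Fin m → (u v : Fin m → ℚ) → ℚ
  postTotal zero    u v = sumAll (greedy (tail v) (tail u) 0ℚ)
  postTotal (suc i) u v = postTotal i (tail u) (tail v)

  postTotal-∈ : ∀ {m} (i : Fin m) {u v} → (∀ j → Admissible D (u j) (v j)) →
                InWindow 0ℚ → InWindow (postTotal i u v)
  postTotal-∈ {suc m} zero    adm 0∈W =
    subst InWindow (+-identityˡ _) (greedy-∈ (admissible-swap ∘ adm ∘ suc) 0∈W m)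
  postTotal-∈ {suc m} (suc i) adm 0∈W = postTotal-∈ i (adm ∘ suc) 0∈W

  module Splice (L R : ℚ) where

    SwitchCondition : ℚ → ℚ → Set
    SwitchCondition u v = ((lo + D) - v ≤ R) × (L ≤ lo + u) × (L + (u + v) ≤ R)

    switchStep : ℚ → ℚ → ℚ → ℚ
    switchStep u v p with L + v ≤? p
    ... | yes _ = v
    ... | no  _ = - u

    switchStep-∈ : ∀ {u v p} → InWindow p → SwitchCondition u v → p - switchStep u v p ∈[ L , R ]
    switchStep-∈ {u} {v} {p} (lo≤p , p≤hi) (hi-v≤R , L≤lo+u , L+u+v≤R) with L + v ≤? p
    ... | yes L+v≤p = above , below
      where
      above : L ≤ p - v
      above = ≤-certified (≤⇒0≤- L+v≤p) (solve (v ∷ p ∷ lo ∷ D ∷ L ∷ R ∷ []) ℚ-ring)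
      below : p - v ≤ R
      below = ≤-certified (0≤+ (≤⇒0≤- p≤hi) (≤⇒0≤- hi-v≤R)) (solve (v ∷ p ∷ lo ∷ D ∷ L ∷ R ∷ []) ℚ-ring)
    ... | no  L+v≰p = above , below
      where
      above : L ≤ p - - u
      above = ≤-certified (0≤+ (≤⇒0≤- lo≤p) (≤⇒0≤- L≤lo+u)) (solve (u ∷ p ∷ lo ∷ D ∷ L ∷ R ∷ []) ℚ-ring)
      below : p - - u ≤ R
      below = ≤-certified (0≤+ (≤⇒0≤- (<⇒≤ (≰⇒> L+v≰p))) (≤⇒0≤- L+u+v≤R))
                          (solve (u ∷ v ∷ p ∷ lo ∷ D ∷ L ∷ R ∷ []) ℚ-ring)

    splice : ∀ {m} → Fin m → (u v : Fin m → ℚ) → ℚ → Fin m → ℚ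
    splice zero    u v p zero    = switchStep (head u) (head v) p
    splice zero    u v p (suc k) = greedy (tail v) (tail u) 0ℚ k
    splice (suc i) u v p zero    = - greedyStep (head u) (head v) p
    splice (suc i) u v p (suc k) = splice i (tail u) (tail v) (p + greedyStep (head u) (head v) p) k

    splice-unsplittable : ∀ {m} (i : Fin m) u v p → IsUnsplittable u v (splice i u v p)
    splice-unsplittable zero u v p zero with L + head v ≤? p
    ... | yes _ = inj₁ refl
    ... | no  _ = inj₂ refl
    splice-unsplittable zero u v p (suc k) = greedy-unsplittable (tail v) (tail u) 0ℚ k
    splice-unsplittable (suc i) u v p zero with p + head u ≤? lo + D
    ... | yes _ = inj₂ refl
    ... | no  _ = inj₁ (⁻¹-involutive (head v))
    splice-unsplittable (suc i) u v p (suc k) = splice-unsplittable i (tail u) (tail v) _ k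

    splice-pre : ∀ {m} (i : Fin m) {u v p} → (∀ j → Admissible D (u j) (v j)) → InWindow p →
                 ∀ k → k ℕ.≤ toℕ i → InWindow (p - sumFirst (splice i u v p) k)
    splice-pre {suc m} i {p = p} _ p∈W zero _ = subst InWindow (sym (+-identityʳ p)) p∈W
    splice-pre (suc i) {u} {v} {p} adm p∈W (suc k) (ℕ.s≤s k≤i) =
      subst InWindow ([p+c]-S≡p-[-c+S] p (greedyStep (head u) (head v) p) _)
        (splice-pre i (adm ∘ suc) (greedyStep-∈ (adm zero) p∈W) k k≤i)

    splice-switch : ∀ {m} (i : Fin m) {u v p} → (∀ j → Admissible D (u j) (v j)) → InWindow p →
                    SwitchCondition (u i) (v i) → p - sumFirst (splice i u v p) (suc (toℕ i)) ∈[ L , R ]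
    splice-switch zero {u} {v} {p} _ p∈W cond =
      subst (λ t → p - t ∈[ L , R ]) (sym (sumFirst-1 (splice zero u v p))) (switchStep-∈ p∈W cond)
    splice-switch (suc i) {u} {v} {p} adm p∈W cond =
      subst (_∈[ L , R ]) ([p+c]-S≡p-[-c+S] p (greedyStep (head u) (head v) p) _)
        (splice-switch i (adm ∘ suc) (greedyStep-∈ (adm zero) p∈W) cond)

    splice-post : ∀ {m} (i : Fin m) {u v p} → (∀ j → Admissible D (u j) (v j)) → InWindow 0ℚ →
                  ∀ k → toℕ i ℕ.< k →
                  InWindow (sumFirst (splice i u v p) k - sumFirst (splice i u v p) (suc (toℕ i)))
    splice-post zero {u} {v} {p} adm 0∈W (suc k) _ =
      subst InWindow (trans (shift s G) (cong (λ t → (s + G) - t) (sym (sumFirst-1 (splice zero u v p)))))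
        (greedy-∈ (admissible-swap ∘ adm ∘ suc) 0∈W k)
      where
      s G : ℚ
      s = switchStep (head u) (head v) p
      G = sumFirst (greedy (tail v) (tail u) 0ℚ) k
      shift : ∀ s G → 0ℚ + G ≡ (s + G) - s
      shift = solve-∀ ℚ-ring
    splice-post (suc i) {u} {v} {p} adm 0∈W (suc k) (ℕ.s≤s i<k) =
      subst InWindow (cancel (- greedyStep (head u) (head v) p) _ _) (splice-post i (adm ∘ suc) 0∈W k i<k)
      where
      cancel : ∀ c S T → S - T ≡ (c + S) - (c + T)
      cancel = solve-∀ ℚ-ring

    splice-sumAll : ∀ {m} (i : Fin m) u v p →
                    sumAll (splice i u v p) ≡ sumFirst (splice i u v p) (suc (toℕ i)) + postTotal i u v
    splice-sumAll zero u v p = cong (_+ postTotal zero u v) (sym (sumFirst-1 (splice zero u v p)))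
    splice-sumAll (suc i) u v p =
      trans (cong (- c +_) (splice-sumAll i (tail u) (tail v) (p + c))) (sym (+-assoc (- c) _ _))
      where
      c : ℚ
      c = greedyStep (head u) (head v) p

  module _ (B : ℚ) where

    L R : ℚ
    L = ((lo + D) + (lo + D)) - B
    R = (lo + lo) + B

    open Splice L R

    splice-edgeIncrease≤ : ∀ {m} (i : Fin m) {u v} → (∀ j → Admissible D (u j) (v j)) → InWindow 0ℚ →
                           SwitchCondition (u i) (v i) →
                           ∀ k → edgeIncrease (splice i u v (postTotal i u v)) k ≤ B
    splice-edgeIncrease≤ i {u} {v} adm 0∈W cond = edge
      where
      Q : ℚ
      Q = postTotal i u v
      z : Fin _ → ℚ
      z = splice i u v Q
      T : ℚ
      T = sumFirst z (suc (toℕ i))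
      A∈LR : Q - T ∈[ L , R ]
      A∈LR = splice-switch i adm (postTotal-∈ i adm 0∈W) cond

      edge-pre : ∀ S T Q → S - ((T + Q) - S) ≡ (Q - T) - ((Q - S) + (Q - S))
      edge-pre = solve-∀ ℚ-ring
      edge-post : ∀ S T Q → S - ((T + Q) - S) ≡ - ((Q - T) - ((S - T) + (S - T)))
      edge-post = solve-∀ ℚ-ring

      edge : ∀ k → ∣ sumFirst z k - (sumAll z - sumFirst z k) ∣ ≤ B
      edge k rewrite splice-sumAll i u v Q with k ℕ.≤? toℕ i
      ... | yes k≤i = subst (λ e → ∣ e ∣ ≤ B) (sym (edge-pre (sumFirst z k) T Q))
                        (∣p-[q+q]∣≤r (splice-pre i adm (postTotal-∈ i adm 0∈W) k k≤i) A∈LR)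
      ... | no  k≰i = subst (λ e → ∣ e ∣ ≤ B) (sym (edge-post (sumFirst z k) T Q))
                        (subst (_≤ B) (sym (∣-p∣≡∣p∣ _))
                          (∣p-[q+q]∣≤r (splice-post i {p = Q} adm 0∈W k (ℕ.≰⇒> k≰i)) A∈LR))

centred-window-feasible : ∀ {D δ a b} → Admissible D a b → δ * D ≤ a + b → a + b ≤ (1ℚ - δ) * D →
  let lo = ½ * ((a - b) - D)
      B  = ((1ℚ + ½) - ½ * δ) * D
      L  = ((lo + D) + (lo + D)) - B
      R  = (lo + lo) + B
  in 0ℚ ∈[ lo , lo + D ] × ((lo + D) - b ≤ R) × (L ≤ lo + a) × (L + (a + b) ≤ R)
centred-window-feasible {D} {δ} {a} {b} adm δD≤a+b a+b≤[1-δ]D =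
    ( ≤-certified (0≤+ slack 0≤b) (solve (D ∷ a ∷ b ∷ []) ℚ-ring)
    , ≤-certified (0≤+ slack 0≤a) (solve (D ∷ a ∷ b ∷ []) ℚ-ring) )
  , ≤-certified margin (solve (D ∷ δ ∷ a ∷ b ∷ []) ℚ-ring)
  , ≤-certified margin (solve (D ∷ δ ∷ a ∷ b ∷ []) ℚ-ring)
  , ≤-certified (≤⇒0≤- a+b≤[1-δ]D) (solve (D ∷ δ ∷ a ∷ b ∷ []) ℚ-ring)
  where
  open Admissible adm
  slack : 0ℚ ≤ ½ * (D - (a + b))
  slack = 0≤½* (≤⇒0≤- a+b≤D)
  margin : 0ℚ ≤ ½ * ((a + b) - δ * D)
  margin = 0≤½* (≤⇒0≤- δD≤a+b)

lemma5 : (m : ℕ) → 1 Data.Nat.≤ m →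
    (u v : Fin m → ℚ) → (∀ i → 0ℚ < u i) → (∀ i → 0ℚ < v i) →
    (δ : ℚ) → 0ℚ ≤ δ →
    (Σ (Fin m) λ i → (δ * Dmax u v ≤ demand u v i) × (demand u v i ≤ (1ℚ - δ) * Dmax u v)) →
    Σ (Fin m → ℚ) λ z → IsUnsplittable u v z × (additivePerformance z ≤ ((1ℚ + ½) - ½ * δ) * Dmax u v)
lemma5 (suc m) _ u v 0<u 0<v δ _ (i , δD≤dᵢ , dᵢ≤[1-δ]D) =
    z , splice-unsplittable i u v Q
  , maxUpTo-lub (edgeIncrease z) m
      (uncurry (splice-edgeIncrease≤ B i adm) (centred-window-feasible {δ = δ} (adm i) δD≤dᵢ dᵢ≤[1-δ]D))
  where
  D B lo Q : ℚ
  D = Dmax u v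
  B = ((1ℚ + ½) - ½ * δ) * D
  lo = ½ * ((u i - v i) - D)
  adm : ∀ j → Admissible D (u j) (v j)
  adm j = record { 0≤a = <⇒≤ (0<u j) ; 0≤b = <⇒≤ (0<v j) ; a+b≤D = maxFin-upper (demand u v) j }
  open Window lo D
  open Splice (L B) (R B)
  Q = postTotal i u v
  z : Fin (suc m) → ℚ
  z = splice i u v Q
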